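{- Let $r$ be a positive integer, let $(x_1,y_1),(x_2,y_2),(x_3,y_3)\in D_r$ be distinct, and let $a,b\in\mathbb{R}$ satisfy \[(x_1,y_1)\cdot(a,b)\equiv(x_2,y_2)\cdot(a,b)\equiv(x_3,y_3)\cdot(a,b)\pmod 1.\] Then there exist integers $p_a,q_a,p_b,q_b$ with $a=p_a/q_a$, $b=p_b/q_b$ and $1\le q_a,q_b\le 8r^2$.
   Context: $D_r=\{(x,y)\in\mathbb{Z}^2: x^2+y^2=r^2\}$, and $\cdot$ denotes the usual dot product. -}

module Defs where

open import Level using (Level)
open import Data.Nat as ℕ using (ℕ; zero; suc)
open import Data.Integer as ℤ using (ℤ; +_; -[1+_])
open import Data.Product using (_×_; _,_; ∃)
open import Relation.Binary.PropositionalEquality using (_≡_)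
open import Algebra.Bundles using (CommutativeRing)

Point : Set
Point = ℤ × ℤ

_∈D_ : Point → ℤ → Set
(x , y) ∈D r = x ℤ.* x ℤ.+ y ℤ.* y ≡ r ℤ.* r

module _ {c ℓ : Level} (R : CommutativeRing c ℓ) where
  open CommutativeRing R

  ιℕ : ℕ → Carrier
  ιℕ zero    = 0#
  ιℕ (suc n) = 1# + ιℕ n

  ι : ℤ → Carrier
  ι (+ n)      = ιℕ n
  ι (-[1+ n ]) = - ιℕ (suc n)

  dot : Point → Carrier → Carrier → Carrier
  dot (x , y) a b = ι x * a + ι y * b

  _≡[mod1]_ : Carrier → Carrier → Set ℓ
  u ≡[mod1] v = ∃ λ (k : ℤ) → u - v ≈ ι k

-- Write u = P₁ − P₂ and v = P₂ − P₃. The two congruences say that u · (a , b) and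
-- v · (a , b) are integers, so by Cramer's rule D a and D b are integers for
-- D = det (u , v). Three distinct points of a circle are never collinear, so D ≠ 0,
-- and every coordinate of u and v is at most 2 r in absolute value, so ∣ D ∣ ≤ 8 r².
module Submission where

open import Defs
open import Level using (Level)
open import Data.Integer using (ℤ; +_; _*_; _≤_)
open import Data.Product using (_×_; Σ; ∃)
open import Relation.Binary.PropositionalEquality using (_≡_)
open import Relation.Nullary using (¬_)
open import Algebra.Bundles using (CommutativeRing)

open import Algebra.Bundles.Raw using (RawRing)
open import Algebra.Solver.Ring.AlmostCommutativeRing
  using (fromCommutativeRing; _-Raw-AlmostCommutative⟶_; Induced-equivalence)
open import Data.Empty using (⊥-elim)
open import Data.Integer as ℤ using (-[1+_]; _⊖_; ∣_∣)
import Data.Integer.Properties as ℤ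
open import Data.Integer.Solver using (module +-*-Solver)
open import Data.Maybe using (just; nothing)
open import Data.Nat as ℕ using (ℕ; zero; suc; _⊔_)
import Data.Nat.Properties as ℕ
open import Data.Nat.Tactic.RingSolver using (solve-∀)
open import Data.Product using (_,_)
open import Data.Sum using (reduce; [_,_]′)
open import Function using (_∘_; id)
open import Relation.Binary.Definitions using (WeaklyDecidable)
open import Relation.Binary.PropositionalEquality as ≡
  using (_≢_; refl; sym; trans; cong; cong₂; subst)
open import Relation.Nullary using (yes; no)

-- Plane geometry over an arbitrary raw ring, so that it can be instantiated both at ℤ
-- and at the ring solver's polynomials: identities stated in vector notation over ℤ
-- are then proved by the solver from the same expressions over polynomials.
module Plane {c ℓ : Level} (R : RawRing c ℓ) where
  open RawRing R renaming (_*_ to _·_)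

  _−ᵖ_ : Carrier × Carrier → Carrier × Carrier → Carrier × Carrier
  (x₁ , y₁) −ᵖ (x₂ , y₂) = x₁ + - x₂ , y₁ + - y₂

  _∙_ : Carrier × Carrier → Carrier × Carrier → Carrier
  (x₁ , y₁) ∙ (x₂ , y₂) = x₁ · x₂ + y₁ · y₂

  ∥_∥² : Carrier × Carrier → Carrier
  ∥ P ∥² = P ∙ P

  det : Carrier × Carrier → Carrier × Carrier → Carrier
  det (x₁ , y₁) (x₂ , y₂) = x₁ · y₂ + - (y₁ · x₂)

open Plane ℤ.+-*-rawRing

polynomials : ℕ → RawRing _ _
polynomials n = record
  { Carrier = +-*-Solver.Polynomial n
  ; _≈_ = _≡_
  ; _+_ = +-*-Solver._:+_
  ; _*_ = +-*-Solver._:*_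
  ; -_ = +-*-Solver.:-_
  ; 0# = +-*-Solver.con (+ 0)
  ; 1# = +-*-Solver.con (+ 1)
  }

module Poly = Plane (polynomials 6)

-- The left side is ∥ u ∥² (v ∙ (u + v)). Dot ∥ u ∥² v − (u ∙ v) u = det u v · (− u₂ , u₁)
-- with 2 P₂ and use 2 P₂ ∙ u = ∥ P₁ ∥² − ∥ P₂ ∥² − ∥ u ∥², 2 P₂ ∙ v = ∥ v ∥² − (∥ P₃ ∥² − ∥ P₂ ∥²).
concyclic-identity : ∀ P₁ P₂ P₃ → let u = P₁ −ᵖ P₂ ; v = P₂ −ᵖ P₃ in
  ∥ u ∥² * ((P₂ −ᵖ P₃) ∙ (P₁ −ᵖ P₃))
    ≡ + 2 * det u P₂ * det u v ℤ.+ ∥ u ∥² * (∥ P₃ ∥² ℤ.- ∥ P₂ ∥²)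
        ℤ.+ u ∙ v * (∥ P₁ ∥² ℤ.- ∥ P₂ ∥²)
concyclic-identity (x₁ , y₁) (x₂ , y₂) (x₃ , y₃) = solve 6 (λ x₁ y₁ x₂ y₂ x₃ y₃ →
    let P₁ = x₁ , y₁ ; P₂ = x₂ , y₂ ; P₃ = x₃ , y₃
        u = P₁ Poly.−ᵖ P₂ ; v = P₂ Poly.−ᵖ P₃ in
    Poly.∥ u ∥² :* ((P₂ Poly.−ᵖ P₃) Poly.∙ (P₁ Poly.−ᵖ P₃))
      := con (+ 2) :* Poly.det u P₂ :* Poly.det u v :+ Poly.∥ u ∥² :* (Poly.∥ P₃ ∥² :- Poly.∥ P₂ ∥²)
           :+ u Poly.∙ v :* (Poly.∥ P₁ ∥² :- Poly.∥ P₂ ∥²))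
  refl x₁ y₁ x₂ y₂ x₃ y₃
  where open +-*-Solver using (solve; _:=_; _:+_; _:*_; _:-_; con)

det-reverse : ∀ P₁ P₂ P₃ → det (P₃ −ᵖ P₂) (P₂ −ᵖ P₁) ≡ ℤ.- det (P₁ −ᵖ P₂) (P₂ −ᵖ P₃)
det-reverse (x₁ , y₁) (x₂ , y₂) (x₃ , y₃) = solve 6 (λ x₁ y₁ x₂ y₂ x₃ y₃ →
    let P₁ = x₁ , y₁ ; P₂ = x₂ , y₂ ; P₃ = x₃ , y₃ in
    Poly.det (P₃ Poly.−ᵖ P₂) (P₂ Poly.−ᵖ P₁) := :- Poly.det (P₁ Poly.−ᵖ P₂) (P₂ Poly.−ᵖ P₃))
  refl x₁ y₁ x₂ y₂ x₃ y₃
  where open +-*-Solver using (solve; _:=_; :-_)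

chord-decomposition : ∀ P₁ P₂ P₃ →
  ∥ P₁ −ᵖ P₃ ∥² ≡ (P₂ −ᵖ P₃) ∙ (P₁ −ᵖ P₃) ℤ.+ (P₂ −ᵖ P₁) ∙ (P₃ −ᵖ P₁)
chord-decomposition (x₁ , y₁) (x₂ , y₂) (x₃ , y₃) = solve 6 (λ x₁ y₁ x₂ y₂ x₃ y₃ →
    let P₁ = x₁ , y₁ ; P₂ = x₂ , y₂ ; P₃ = x₃ , y₃ in
    Poly.∥ P₁ Poly.−ᵖ P₃ ∥²
      := (P₂ Poly.−ᵖ P₃) Poly.∙ (P₁ Poly.−ᵖ P₃) :+ (P₂ Poly.−ᵖ P₁) Poly.∙ (P₃ Poly.−ᵖ P₁))
  refl x₁ y₁ x₂ y₂ x₃ y₃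
  where open +-*-Solver using (solve; _:=_; _:+_)

i*i≡+∣i∣*∣i∣ : ∀ i → i * i ≡ + (∣ i ∣ ℕ.* ∣ i ∣)
i*i≡+∣i∣*∣i∣ (+ n)    = sym (ℤ.pos-* n n)
i*i≡+∣i∣*∣i∣ -[1+ n ] = refl

∥P∥²≡+∣x∣²+∣y∣² : ∀ x y → ∥ (x , y) ∥² ≡ + (∣ x ∣ ℕ.* ∣ x ∣ ℕ.+ ∣ y ∣ ℕ.* ∣ y ∣)
∥P∥²≡+∣x∣²+∣y∣² x y = trans (cong₂ ℤ._+_ (i*i≡+∣i∣*∣i∣ x) (i*i≡+∣i∣*∣i∣ y))
  (sym (ℤ.pos-+ (∣ x ∣ ℕ.* ∣ x ∣) (∣ y ∣ ℕ.* ∣ y ∣)))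

∥P−Q∥²≡0⇒P≡Q : ∀ P Q → ∥ P −ᵖ Q ∥² ≡ + 0 → P ≡ Q
∥P−Q∥²≡0⇒P≡Q (x₁ , y₁) (x₂ , y₂) ∥P−Q∥²≡0 =
  cong₂ _,_ (ℤ.i-j≡0⇒i≡j x₁ x₂ (square≡0⇒≡0 (x₁ ℤ.- x₂) (ℕ.m+n≡0⇒m≡0 _ squares≡0)))
            (ℤ.i-j≡0⇒i≡j y₁ y₂ (square≡0⇒≡0 (y₁ ℤ.- y₂) (ℕ.m+n≡0⇒n≡0 _ squares≡0)))
  where
  squares≡0 : ∣ x₁ ℤ.- x₂ ∣ ℕ.* ∣ x₁ ℤ.- x₂ ∣ ℕ.+ ∣ y₁ ℤ.- y₂ ∣ ℕ.* ∣ y₁ ℤ.- y₂ ∣ ≡ 0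
  squares≡0 = ℤ.+-injective (trans (sym (∥P∥²≡+∣x∣²+∣y∣² (x₁ ℤ.- x₂) (y₁ ℤ.- y₂))) ∥P−Q∥²≡0)

  square≡0⇒≡0 : ∀ i → ∣ i ∣ ℕ.* ∣ i ∣ ≡ 0 → i ≡ + 0
  square≡0⇒≡0 i ∣i∣²≡0 = ℤ.∣i∣≡0⇒i≡0 (reduce (ℕ.m*n≡0⇒m≡0∨n≡0 ∣ i ∣ ∣i∣²≡0))

linear-combination≡0 : ∀ a b c {d e f} → d ≡ + 0 → e ≡ + 0 → f ≡ + 0 →
  a * d ℤ.+ b * e ℤ.+ c * f ≡ + 0
linear-combination≡0 a b c refl refl refl
  rewrite ℤ.*-zeroʳ a | ℤ.*-zeroʳ b | ℤ.*-zeroʳ c = refl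

collinear⇒chords-orthogonal : ∀ P₁ P₂ P₃ → ∥ P₁ ∥² ≡ ∥ P₂ ∥² → ∥ P₃ ∥² ≡ ∥ P₂ ∥² → P₁ ≢ P₂ →
  det (P₁ −ᵖ P₂) (P₂ −ᵖ P₃) ≡ + 0 → (P₂ −ᵖ P₃) ∙ (P₁ −ᵖ P₃) ≡ + 0
collinear⇒chords-orthogonal P₁ P₂ P₃ ∥P₁∥²≡∥P₂∥² ∥P₃∥²≡∥P₂∥² P₁≢P₂ det≡0 =
  [ ⊥-elim ∘ P₁≢P₂ ∘ ∥P−Q∥²≡0⇒P≡Q P₁ P₂ , id ]′
    (ℤ.i*j≡0⇒i≡0∨j≡0 ∥ P₁ −ᵖ P₂ ∥² product≡0)
  where
  u : Point
  u = P₁ −ᵖ P₂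
  product≡0 : ∥ u ∥² * ((P₂ −ᵖ P₃) ∙ (P₁ −ᵖ P₃)) ≡ + 0
  product≡0 = trans (concyclic-identity P₁ P₂ P₃)
    (linear-combination≡0 (+ 2 * det u P₂) ∥ u ∥² (u ∙ (P₂ −ᵖ P₃))
      det≡0 (ℤ.i≡j⇒i-j≡0 ∥P₃∥²≡∥P₂∥²) (ℤ.i≡j⇒i-j≡0 ∥P₁∥²≡∥P₂∥²))

concyclic-distinct⇒det≢0 : ∀ P₁ P₂ P₃ → ∥ P₁ ∥² ≡ ∥ P₂ ∥² → ∥ P₃ ∥² ≡ ∥ P₂ ∥² →
  P₁ ≢ P₂ → P₁ ≢ P₃ → P₂ ≢ P₃ → det (P₁ −ᵖ P₂) (P₂ −ᵖ P₃) ≢ + 0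
concyclic-distinct⇒det≢0 P₁ P₂ P₃ ∥P₁∥²≡∥P₂∥² ∥P₃∥²≡∥P₂∥² P₁≢P₂ P₁≢P₃ P₂≢P₃ det≡0 =
  P₁≢P₃ (∥P−Q∥²≡0⇒P≡Q P₁ P₃ (begin
    ∥ P₁ −ᵖ P₃ ∥²                                         ≡⟨ chord-decomposition P₁ P₂ P₃ ⟩
    (P₂ −ᵖ P₃) ∙ (P₁ −ᵖ P₃) ℤ.+ (P₂ −ᵖ P₁) ∙ (P₃ −ᵖ P₁)
      ≡⟨ cong₂ ℤ._+_ chords⊥-at-P₃ chords⊥-at-P₁ ⟩
    + 0                                                   ∎))
  where
  open ≡.≡-Reasoning
  chords⊥-at-P₃ : (P₂ −ᵖ P₃) ∙ (P₁ −ᵖ P₃) ≡ + 0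
  chords⊥-at-P₃ = collinear⇒chords-orthogonal P₁ P₂ P₃ ∥P₁∥²≡∥P₂∥² ∥P₃∥²≡∥P₂∥² P₁≢P₂ det≡0
  chords⊥-at-P₁ : (P₂ −ᵖ P₁) ∙ (P₃ −ᵖ P₁) ≡ + 0
  chords⊥-at-P₁ = collinear⇒chords-orthogonal P₃ P₂ P₁ ∥P₃∥²≡∥P₂∥² ∥P₁∥²≡∥P₂∥² (P₂≢P₃ ∘ sym)
    (trans (det-reverse P₁ P₂ P₃) (cong ℤ.-_ det≡0))

∣_∣∞ : Point → ℕ
∣ (x , y) ∣∞ = ∣ x ∣ ⊔ ∣ y ∣

m*m≤n*n⇒m≤n : ∀ {m n} → m ℕ.* m ℕ.≤ n ℕ.* n → m ℕ.≤ n
m*m≤n*n⇒m≤n m*m≤n*n = ℕ.≮⇒≥ (λ n<m → ℕ.<⇒≱ (ℕ.*-mono-< n<m n<m) m*m≤n*n)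

∥P∥²≡r*r⇒∣P∣∞≤∣r∣ : ∀ P r → ∥ P ∥² ≡ r * r → ∣ P ∣∞ ℕ.≤ ∣ r ∣
∥P∥²≡r*r⇒∣P∣∞≤∣r∣ (x , y) r ∥P∥²≡r*r = ℕ.⊔-lub
  (m*m≤n*n⇒m≤n {∣ x ∣} (ℕ.≤-trans (ℕ.m≤m+n (∣ x ∣ ℕ.* ∣ x ∣) (∣ y ∣ ℕ.* ∣ y ∣)) squares≤r*r))
  (m*m≤n*n⇒m≤n {∣ y ∣} (ℕ.≤-trans (ℕ.m≤n+m (∣ y ∣ ℕ.* ∣ y ∣) (∣ x ∣ ℕ.* ∣ x ∣)) squares≤r*r))
  where
  squares≤r*r : ∣ x ∣ ℕ.* ∣ x ∣ ℕ.+ ∣ y ∣ ℕ.* ∣ y ∣ ℕ.≤ ∣ r ∣ ℕ.* ∣ r ∣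
  squares≤r*r = ℕ.≤-reflexive (ℤ.+-injective
    (trans (sym (∥P∥²≡+∣x∣²+∣y∣² x y)) (trans ∥P∥²≡r*r (i*i≡+∣i∣*∣i∣ r))))

∣P−Q∣∞≤∣P∣∞+∣Q∣∞ : ∀ P Q → ∣ P −ᵖ Q ∣∞ ℕ.≤ ∣ P ∣∞ ℕ.+ ∣ Q ∣∞
∣P−Q∣∞≤∣P∣∞+∣Q∣∞ (x₁ , y₁) (x₂ , y₂) = ℕ.⊔-lub
  (ℕ.≤-trans (ℤ.∣i-j∣≤∣i∣+∣j∣ x₁ x₂) (ℕ.+-mono-≤ (ℕ.m≤m⊔n ∣ x₁ ∣ ∣ y₁ ∣) (ℕ.m≤m⊔n ∣ x₂ ∣ ∣ y₂ ∣)))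
  (ℕ.≤-trans (ℤ.∣i-j∣≤∣i∣+∣j∣ y₁ y₂) (ℕ.+-mono-≤ (ℕ.m≤n⊔m ∣ x₁ ∣ ∣ y₁ ∣) (ℕ.m≤n⊔m ∣ x₂ ∣ ∣ y₂ ∣)))

∣det∣≤2*∣u∣∞*∣v∣∞ : ∀ u v → ∣ det u v ∣ ℕ.≤ 2 ℕ.* (∣ u ∣∞ ℕ.* ∣ v ∣∞)
∣det∣≤2*∣u∣∞*∣v∣∞ (x₁ , y₁) (x₂ , y₂) = begin
  ∣ x₁ * y₂ ℤ.- y₁ * x₂ ∣
    ≤⟨ ℤ.∣i-j∣≤∣i∣+∣j∣ (x₁ * y₂) (y₁ * x₂) ⟩
  ∣ x₁ * y₂ ∣ ℕ.+ ∣ y₁ * x₂ ∣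
    ≡⟨ cong₂ ℕ._+_ (ℤ.abs-* x₁ y₂) (ℤ.abs-* y₁ x₂) ⟩
  ∣ x₁ ∣ ℕ.* ∣ y₂ ∣ ℕ.+ ∣ y₁ ∣ ℕ.* ∣ x₂ ∣
    ≤⟨ ℕ.+-mono-≤ (ℕ.*-mono-≤ (ℕ.m≤m⊔n ∣ x₁ ∣ ∣ y₁ ∣) (ℕ.m≤n⊔m ∣ x₂ ∣ ∣ y₂ ∣))
                  (ℕ.*-mono-≤ (ℕ.m≤n⊔m ∣ x₁ ∣ ∣ y₁ ∣) (ℕ.m≤m⊔n ∣ x₂ ∣ ∣ y₂ ∣)) ⟩
  ∣u∣∞∣v∣∞ ℕ.+ ∣u∣∞∣v∣∞
    ≡⟨ cong (∣u∣∞∣v∣∞ ℕ.+_) (ℕ.+-identityʳ ∣u∣∞∣v∣∞) ⟨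
  2 ℕ.* ∣u∣∞∣v∣∞
    ∎
  where
  open ℕ.≤-Reasoning
  ∣u∣∞∣v∣∞ : ℕ
  ∣u∣∞∣v∣∞ = ∣ (x₁ , y₁) ∣∞ ℕ.* ∣ (x₂ , y₂) ∣∞

concyclic-det-bound : ∀ P₁ P₂ P₃ r → ∥ P₁ ∥² ≡ r * r → ∥ P₂ ∥² ≡ r * r → ∥ P₃ ∥² ≡ r * r →
  ∣ det (P₁ −ᵖ P₂) (P₂ −ᵖ P₃) ∣ ℕ.≤ 8 ℕ.* (∣ r ∣ ℕ.* ∣ r ∣)
concyclic-det-bound P₁ P₂ P₃ r on₁ on₂ on₃ = begin
  ∣ det (P₁ −ᵖ P₂) (P₂ −ᵖ P₃) ∣
    ≤⟨ ∣det∣≤2*∣u∣∞*∣v∣∞ (P₁ −ᵖ P₂) (P₂ −ᵖ P₃) ⟩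
  2 ℕ.* (∣ P₁ −ᵖ P₂ ∣∞ ℕ.* ∣ P₂ −ᵖ P₃ ∣∞)
    ≤⟨ ℕ.*-monoʳ-≤ 2 (ℕ.*-mono-≤ (chord≤2r P₁ P₂ on₁ on₂) (chord≤2r P₂ P₃ on₂ on₃)) ⟩
  2 ℕ.* ((∣ r ∣ ℕ.+ ∣ r ∣) ℕ.* (∣ r ∣ ℕ.+ ∣ r ∣))
    ≡⟨ 2*[n+n]*[n+n]≡8*n*n ∣ r ∣ ⟩
  8 ℕ.* (∣ r ∣ ℕ.* ∣ r ∣)
    ∎
  where
  open ℕ.≤-Reasoning
  chord≤2r : ∀ P Q → ∥ P ∥² ≡ r * r → ∥ Q ∥² ≡ r * r → ∣ P −ᵖ Q ∣∞ ℕ.≤ ∣ r ∣ ℕ.+ ∣ r ∣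
  chord≤2r P Q onP onQ = ℕ.≤-trans (∣P−Q∣∞≤∣P∣∞+∣Q∣∞ P Q)
    (ℕ.+-mono-≤ (∥P∥²≡r*r⇒∣P∣∞≤∣r∣ P r onP) (∥P∥²≡r*r⇒∣P∣∞≤∣r∣ Q r onQ))
  2*[n+n]*[n+n]≡8*n*n : ∀ n → 2 ℕ.* ((n ℕ.+ n) ℕ.* (n ℕ.+ n)) ≡ 8 ℕ.* (n ℕ.* n)
  2*[n+n]*[n+n]≡8*n*n = solve-∀

module IntegerCast {c ℓ : Level} (R : CommutativeRing c ℓ) where
  open CommutativeRing R renaming (_*_ to _·_; refl to ≈-refl; sym to ≈-sym; trans to ≈-trans)
  open import Algebra.Properties.Ring ring using (-0#≈0#; -‿involutive; -‿distribˡ-*)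
  open import Algebra.Properties.Semiring.Mult semiring
    using (×-homo-+; ×1-homo-*) renaming (_×_ to _×ₙ_)
  open import Algebra.Properties.AbelianGroup +-abelianGroup using (⁻¹-∙-comm)
  open import Algebra.Properties.CommutativeSemigroup +-commutativeSemigroup
    using (interchange; x∙yz≈y∙xz)
  open import Relation.Binary.Reasoning.Setoid setoid

  ιℕ≡×1# : ∀ n → ιℕ R n ≡ n ×ₙ 1#
  ιℕ≡×1# zero    = ≡.refl
  ιℕ≡×1# (suc n) = ≡.cong (_+_ 1#) (ιℕ≡×1# n)

  ιℕ-+ : ∀ m n → ιℕ R (m ℕ.+ n) ≈ ιℕ R m + ιℕ R n
  ιℕ-+ m n rewrite ιℕ≡×1# (m ℕ.+ n) | ιℕ≡×1# m | ιℕ≡×1# n = ×-homo-+ 1# m n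

  ιℕ-* : ∀ m n → ιℕ R (m ℕ.* n) ≈ ιℕ R m · ιℕ R n
  ιℕ-* m n rewrite ιℕ≡×1# (m ℕ.* n) | ιℕ≡×1# m | ιℕ≡×1# n = ×1-homo-* m n

  ι-⊖ : ∀ m n → ι R (m ⊖ n) ≈ ιℕ R m - ιℕ R n
  ι-⊖ zero    zero    = ≈-sym (-‿inverseʳ 0#)
  ι-⊖ zero    (suc n) = ≈-sym (+-identityˡ _)
  ι-⊖ (suc m) zero    = ≈-sym (≈-trans (+-congˡ -0#≈0#) (+-identityʳ _))
  ι-⊖ (suc m) (suc n) = begin
    ι R (suc m ⊖ suc n)                  ≡⟨ ≡.cong (ι R) (ℤ.[1+m]⊖[1+n]≡m⊖n m n) ⟩
    ι R (m ⊖ n)                          ≈⟨ ι-⊖ m n ⟩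
    ιℕ R m - ιℕ R n                      ≈⟨ +-identityˡ _ ⟨
    0# + (ιℕ R m - ιℕ R n)               ≈⟨ +-congʳ (-‿inverseʳ 1#) ⟨
    (1# - 1#) + (ιℕ R m - ιℕ R n)        ≈⟨ interchange 1# (- 1#) (ιℕ R m) (- ιℕ R n) ⟩
    (1# + ιℕ R m) + (- 1# - ιℕ R n)      ≈⟨ +-congˡ (⁻¹-∙-comm 1# (ιℕ R n)) ⟩
    (1# + ιℕ R m) - (1# + ιℕ R n)        ∎

  ι-neg : ∀ i → ι R (ℤ.- i) ≈ - ι R i
  ι-neg (+ zero)   = ≈-sym -0#≈0#
  ι-neg (+ suc n)  = ≈-refl
  ι-neg -[1+ n ]   = ≈-sym (-‿involutive _)

  ι-+ : ∀ i j → ι R (i ℤ.+ j) ≈ ι R i + ι R j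
  ι-+ (+ m)    (+ n)    = ιℕ-+ m n
  ι-+ (+ m)    -[1+ n ] = ι-⊖ m (suc n)
  ι-+ -[1+ m ] (+ n)    = ≈-trans (ι-⊖ n (suc m)) (+-comm _ _)
  ι-+ -[1+ m ] -[1+ n ] = begin
    - (1# + ιℕ R (suc m ℕ.+ n))          ≈⟨ -‿cong (+-congˡ (ιℕ-+ (suc m) n)) ⟩
    - (1# + (ιℕ R (suc m) + ιℕ R n))     ≈⟨ -‿cong (x∙yz≈y∙xz _ _ _) ⟩
    - (ιℕ R (suc m) + ιℕ R (suc n))      ≈⟨ ⁻¹-∙-comm _ _ ⟨
    - ιℕ R (suc m) - ιℕ R (suc n)        ∎

  ι-pos-* : ∀ n j → ι R (+ n ℤ.* j) ≈ ιℕ R n · ι R j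
  ι-pos-* zero    j = ≈-trans (reflexive (≡.cong (ι R) (ℤ.*-zeroˡ j))) (≈-sym (zeroˡ _))
  ι-pos-* (suc n) j = begin
    ι R (+ suc n ℤ.* j)                  ≡⟨ ≡.cong (ι R) (ℤ.suc-* (+ n) j) ⟩
    ι R (j ℤ.+ + n ℤ.* j)                ≈⟨ ι-+ j (+ n ℤ.* j) ⟩
    ι R j + ι R (+ n ℤ.* j)              ≈⟨ +-cong (≈-sym (*-identityˡ _)) (ι-pos-* n j) ⟩
    1# · ι R j + ιℕ R n · ι R j          ≈⟨ distribʳ _ _ _ ⟨
    (1# + ιℕ R n) · ι R j                ∎

  ι-* : ∀ i j → ι R (i ℤ.* j) ≈ ι R i · ι R j
  ι-* (+ n)    j = ι-pos-* n j
  ι-* -[1+ n ] j = begin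
    ι R (-[1+ n ] ℤ.* j)                 ≡⟨ ≡.cong (ι R) (ℤ.neg-distribˡ-* (+ suc n) j) ⟨
    ι R (ℤ.- (+ suc n ℤ.* j))            ≈⟨ ι-neg (+ suc n ℤ.* j) ⟩
    - ι R (+ suc n ℤ.* j)                ≈⟨ -‿cong (ι-pos-* (suc n) j) ⟩
    - (ιℕ R (suc n) · ι R j)             ≈⟨ -‿distribˡ-* _ _ ⟩
    - ιℕ R (suc n) · ι R j               ∎

  ι-morphism : ℤ.+-*-rawRing -Raw-AlmostCommutative⟶ fromCommutativeRing R
  ι-morphism = record
    { ⟦_⟧ = ι R ; +-homo = ι-+ ; *-homo = ι-* ; -‿homo = ι-neg
    ; 0-homo = ≈-refl ; 1-homo = +-identityʳ 1# }

  ι-≟ : WeaklyDecidable (Induced-equivalence ι-morphism)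
  ι-≟ i j with i ℤ.≟ j
  ... | yes ≡.refl = just ≈-refl
  ... | no _       = nothing

  ι-− : ∀ i j → ι R (i ℤ.- j) ≈ ι R i - ι R j
  ι-− i j = ≈-trans (ι-+ i (ℤ.- j)) (+-congˡ (ι-neg j))

  ι-*-−-* : ∀ i j k l → ι R (i * j ℤ.- k * l) ≈ ι R i · ι R j - ι R k · ι R l
  ι-*-−-* i j k l = ≈-trans (ι-− (i * j) (k * l)) (+-cong (ι-* i j) (-‿cong (ι-* k l)))

module Cramer {c ℓ : Level} (R : CommutativeRing c ℓ) where
  open CommutativeRing R renaming (_*_ to _·_; refl to ≈-refl; sym to ≈-sym; trans to ≈-trans)
  open import Algebra.Properties.Ring ring using (-‿involutive; -‿distribˡ-*)
  open import Relation.Binary.Reasoning.Setoid setoid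
  open IntegerCast R
  open import Algebra.Solver.Ring ℤ.+-*-rawRing (fromCommutativeRing R) ι-morphism ι-≟
    using (solve; _:=_; _:+_; _:*_; _:-_)

  Integral : Carrier → Set ℓ
  Integral x = ∃ λ k → x ≈ ι R k

  Integral-resp : ∀ {x y} → x ≈ y → Integral y → Integral x
  Integral-resp x≈y (k , y≈k) = k , ≈-trans x≈y y≈k

  Integral-combination : ∀ m n {x y} → Integral x → Integral y → Integral (ι R m · x - ι R n · y)
  Integral-combination m n (k , x≈k) (l , y≈l) = m * k ℤ.- n * l ,
    ≈-trans (+-cong (*-congˡ x≈k) (-‿cong (*-congˡ y≈l))) (≈-sym (ι-*-−-* m k n l))

  Integral-∣∣ : ∀ q {x} → Integral (ι R q · x) → Integral (ι R (+ ∣ q ∣) · x)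
  Integral-∣∣ (+ n)    qx∈ℤ           = qx∈ℤ
  Integral-∣∣ -[1+ n ] {x} (k , qx≈k) = ℤ.- k , (begin
    ιℕ R (suc n) · x          ≈⟨ *-congʳ (-‿involutive (ιℕ R (suc n))) ⟨
    - (- ιℕ R (suc n)) · x    ≈⟨ -‿distribˡ-* (- ιℕ R (suc n)) x ⟨
    - (- ιℕ R (suc n) · x)    ≈⟨ -‿cong qx≈k ⟩
    - ι R k                   ≈⟨ ι-neg k ⟨
    ι R (ℤ.- k)               ∎)

  dot-−ᵖ : ∀ P Q a b → dot R P a b - dot R Q a b ≈ dot R (P −ᵖ Q) a b
  dot-−ᵖ (x₁ , y₁) (x₂ , y₂) a b = begin
    (ι R x₁ · a + ι R y₁ · b) - (ι R x₂ · a + ι R y₂ · b)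
      ≈⟨ solve 6 (λ x₁ y₁ x₂ y₂ a b →
           (x₁ :* a :+ y₁ :* b) :- (x₂ :* a :+ y₂ :* b) := (x₁ :- x₂) :* a :+ (y₁ :- y₂) :* b)
           ≈-refl (ι R x₁) (ι R y₁) (ι R x₂) (ι R y₂) a b ⟩
    (ι R x₁ - ι R x₂) · a + (ι R y₁ - ι R y₂) · b
      ≈⟨ +-cong (*-congʳ (ι-− x₁ x₂)) (*-congʳ (ι-− y₁ y₂)) ⟨
    ι R (x₁ ℤ.- x₂) · a + ι R (y₁ ℤ.- y₂) · b
      ∎

  cramer : ∀ u v a b → Integral (dot R u a b) → Integral (dot R v a b) →
    Integral (ι R (det u v) · a) × Integral (ι R (det u v) · b)
  cramer (u₁ , u₂) (v₁ , v₂) a b u·ab∈ℤ v·ab∈ℤ =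
    Integral-resp (≈-trans ι-det (solve 6 (λ u₁ u₂ v₁ v₂ a b →
        (u₁ :* v₂ :- u₂ :* v₁) :* a := v₂ :* (u₁ :* a :+ u₂ :* b) :- u₂ :* (v₁ :* a :+ v₂ :* b))
        ≈-refl U₁ U₂ V₁ V₂ a b))
      (Integral-combination v₂ u₂ u·ab∈ℤ v·ab∈ℤ) ,
    Integral-resp (≈-trans ι-det (solve 6 (λ u₁ u₂ v₁ v₂ a b →
        (u₁ :* v₂ :- u₂ :* v₁) :* b := u₁ :* (v₁ :* a :+ v₂ :* b) :- v₁ :* (u₁ :* a :+ u₂ :* b))
        ≈-refl U₁ U₂ V₁ V₂ a b))
      (Integral-combination u₁ v₁ v·ab∈ℤ u·ab∈ℤ)
    where
    U₁ U₂ V₁ V₂ : Carrier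
    U₁ = ι R u₁ ; U₂ = ι R u₂ ; V₁ = ι R v₁ ; V₂ = ι R v₂
    ι-det : ∀ {z} → ι R (det (u₁ , u₂) (v₁ , v₂)) · z ≈ (U₁ · V₂ - U₂ · V₁) · z
    ι-det = *-congʳ (ι-*-−-* u₁ v₂ u₂ v₁)

  congruent-dots⇒det-clears : ∀ P₁ P₂ P₃ a b →
    _≡[mod1]_ R (dot R P₁ a b) (dot R P₂ a b) → _≡[mod1]_ R (dot R P₂ a b) (dot R P₃ a b) →
    let D = det (P₁ −ᵖ P₂) (P₂ −ᵖ P₃) in Integral (ι R D · a) × Integral (ι R D · b)
  congruent-dots⇒det-clears P₁ P₂ P₃ a b P₁∼P₂ P₂∼P₃ = cramer (P₁ −ᵖ P₂) (P₂ −ᵖ P₃) a b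
    (Integral-resp (≈-sym (dot-−ᵖ P₁ P₂ a b)) P₁∼P₂)
    (Integral-resp (≈-sym (dot-−ᵖ P₂ P₃ a b)) P₂∼P₃)

lemma11 : {c ℓ : Level} (R : CommutativeRing c ℓ) (r : ℤ) → + 1 ≤ r →
    (P₁ P₂ P₃ : Point) → P₁ ∈D r → P₂ ∈D r → P₃ ∈D r →
    ¬ (P₁ ≡ P₂) → ¬ (P₁ ≡ P₃) → ¬ (P₂ ≡ P₃) →
    (a b : CommutativeRing.Carrier R) →
    _≡[mod1]_ R (dot R P₁ a b) (dot R P₂ a b) →
    _≡[mod1]_ R (dot R P₂ a b) (dot R P₃ a b) →
    Σ ℤ λ pa → Σ ℤ λ qa → Σ ℤ λ pb → Σ ℤ λ qb →
      CommutativeRing._≈_ R (CommutativeRing._*_ R (ι R qa) a) (ι R pa) ×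
      CommutativeRing._≈_ R (CommutativeRing._*_ R (ι R qb) b) (ι R pb) ×
      + 1 ≤ qa × qa ≤ + 8 * (r * r) ×
      + 1 ≤ qb × qb ≤ + 8 * (r * r)
lemma11 R r _ P₁ P₂ P₃ on₁ on₂ on₃ P₁≢P₂ P₁≢P₃ P₂≢P₃ a b P₁∼P₂ P₂∼P₃ =
  let (Da∈ℤ , Db∈ℤ) = congruent-dots⇒det-clears P₁ P₂ P₃ a b P₁∼P₂ P₂∼P₃
      (pa , ∣D∣a≈pa) = Integral-∣∣ D Da∈ℤ
      (pb , ∣D∣b≈pb) = Integral-∣∣ D Db∈ℤ
  in pa , + ∣ D ∣ , pb , + ∣ D ∣ , ∣D∣a≈pa , ∣D∣b≈pb , 1≤∣D∣ , ∣D∣≤8r² , 1≤∣D∣ , ∣D∣≤8r²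
  where
  open Cramer R
  D : ℤ
  D = det (P₁ −ᵖ P₂) (P₂ −ᵖ P₃)
  D≢0 : D ≢ + 0
  D≢0 = concyclic-distinct⇒det≢0 P₁ P₂ P₃ (trans on₁ (sym on₂)) (trans on₃ (sym on₂))
    P₁≢P₂ P₁≢P₃ P₂≢P₃
  1≤∣D∣ : + 1 ≤ + ∣ D ∣
  1≤∣D∣ = ℤ.+≤+ (ℕ.n≢0⇒n>0 (D≢0 ∘ ℤ.∣i∣≡0⇒i≡0))
  ∣D∣≤8r² : + ∣ D ∣ ≤ + 8 * (r * r)
  ∣D∣≤8r² = subst (+ ∣ D ∣ ≤_)
    (trans (ℤ.pos-* 8 (∣ r ∣ ℕ.* ∣ r ∣)) (cong (_*_ (+ 8)) (sym (i*i≡+∣i∣*∣i∣ r))))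
    (ℤ.+≤+ (concyclic-det-bound P₁ P₂ P₃ r on₁ on₂ on₃))
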